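{- Let $n\geq 3$ and let $PC_n$ be the paramecium graph. Then $$\sigma^{\times}_V(PC_n)=\left\lfloor\frac{n}{2}\right\rfloor \quad\text{and}\quad \sigma^{\square}_V(PC_n)=\sigma^{\boxtimes}_V(PC_n)=\left\lceil\frac{n}{2}\right\rceil.$$
   Context: The paramecium graph $PC_n$ ($n\geq3$) is obtained from the cycle $C_n$ with vertices $v_1,\dots,v_n$ (edges $v_iv_{i+1}$ for $1\le i\le n-1$ and $v_nv_1$) by adding $n$ new vertices $u_1,\dots,u_n$ and edges $u_iv_i$ for each $i$. For a finite simple connected graph $G$ with distance $d_G$ and $l\in\mathbb{N}$, let $\mathbb{N}_l=\{1,\dots,l\}$. An $l$-track on $G$ is a surjective $f:\mathbb{N}_l\to V(G)$ with $f(i)f(i+1)\in E(G)$ for all $i<l$; a lazy $l$-track is a surjective $f:\mathbb{N}_l\to V(G)$ with $f(i)f(i+1)\in E(G)$ or $f(i)=f(i+1)$ for all $i<l$; lazy $l$-tracks $f,g$ are opposite if for every $i<l$, either ($f(i)f(i+1)\in E(G)$ and $g(i)=g(i+1)$) or ($g(i)g(i+1)\in E(G)$ and $f(i)=f(i+1)$). Let $m_G(f,g)=\min_{i\in\mathbb{N}_l} d_G(f(i),g(i))$. The strong, direct and Cartesian vertex spans $\sigma^{\boxtimes}_V(G)$, $\sigma^{\times}_V(G)$, $\sigma^{\square}_V(G)$ are the maxima of $m_G(f,g)$ over all $l$ and all pairs of, respectively, lazy $l$-tracks, $l$-tracks, and opposite lazy $l$-tracks on $G$. -}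

module Defs where

open import Data.Nat using (ℕ; zero; suc; _≤_)
open import Data.Fin using (Fin; toℕ)
open import Data.Sum using (_⊎_; inj₁; inj₂)
open import Data.Product using (Σ; ∃; _×_; _,_)
open import Relation.Binary.PropositionalEquality using (_≡_)

record Graph : Set₁ where
  field
    V   : Set
    Adj : V → V → Set
open Graph public

data Walk (G : Graph) : V G → V G → ℕ → Set where
  here : ∀ {u} → Walk G u u zero
  step : ∀ {u w v k} → Adj G u w → Walk G w v k → Walk G u v (suc k)

Dist : (G : Graph) → V G → V G → ℕ → Set
Dist G u v k = Walk G u v k × (∀ m → Walk G u v m → k ≤ m)

-- Paramecium graph PC_n: inj₁ i is the cycle vertex v_{i+1}, inj₂ i is the pendant u_{i+1}.
CycAdj : (n : ℕ) → Fin n → Fin n → Set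
CycAdj n i j =
  (toℕ j ≡ suc (toℕ i)) ⊎ (toℕ i ≡ suc (toℕ j)) ⊎
  ((suc (toℕ i) ≡ n × toℕ j ≡ 0) ⊎ (suc (toℕ j) ≡ n × toℕ i ≡ 0))

data PCAdj (n : ℕ) : Fin n ⊎ Fin n → Fin n ⊎ Fin n → Set where
  cyc  : ∀ {i j} → CycAdj n i j → PCAdj n (inj₁ i) (inj₁ j)
  vu   : ∀ i → PCAdj n (inj₁ i) (inj₂ i)
  uv   : ∀ i → PCAdj n (inj₂ i) (inj₁ i)

PC : ℕ → Graph
PC n = record { V = Fin n ⊎ Fin n ; Adj = PCAdj n }

-- Maps N_l → V(G), with N_l = {1..l} represented by Fin l.
Map : Graph → ℕ → Set
Map G l = Fin l → V G

Surjective : (G : Graph) {l : ℕ} → Map G l → Set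
Surjective G {l} f = ∀ v → ∃ λ (i : Fin l) → f i ≡ v

Consec : {l : ℕ} → Fin l → Fin l → Set
Consec i j = toℕ j ≡ suc (toℕ i)

Track : (G : Graph) {l : ℕ} → Map G l → Set
Track G f = Surjective G f × (∀ i j → Consec i j → Adj G (f i) (f j))

LazyTrack : (G : Graph) {l : ℕ} → Map G l → Set
LazyTrack G f = Surjective G f × (∀ i j → Consec i j → Adj G (f i) (f j) ⊎ f i ≡ f j)

Opposite : (G : Graph) {l : ℕ} → Map G l → Map G l → Set
Opposite G f g = ∀ i j → Consec i j →
  (Adj G (f i) (f j) × g i ≡ g j) ⊎ (Adj G (g i) (g j) × f i ≡ f j)

MinDist : (G : Graph) {l : ℕ} → Map G l → Map G l → ℕ → Set
MinDist G {l} f g k =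
  (∃ λ (i : Fin l) → Dist G (f i) (g i) k) ×
  (∀ (i : Fin l) k' → Dist G (f i) (g i) k' → k ≤ k')

IsMaxSpan : (G : Graph) → (∀ {l} → Map G l → Map G l → Set) → ℕ → Set
IsMaxSpan G P k =
  (Σ ℕ λ l → Σ (Map G l) λ f → Σ (Map G l) λ g → P f g × MinDist G f g k) ×
  (∀ l (f g : Map G l) k' → P f g → MinDist G f g k' → k' ≤ k)

StrongSpan DirectSpan CartesianSpan : Graph → ℕ → Set
StrongSpan G = IsMaxSpan G (λ f g → LazyTrack G f × LazyTrack G g)
DirectSpan G = IsMaxSpan G (λ f g → Track G f × Track G g)
CartesianSpan G = IsMaxSpan G (λ f g → LazyTrack G f × LazyTrack G g × Opposite G f g)

-- Distances in PC_n are explicit: if δ is the cyclic distance of the base indices then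
-- d(v_i, v_j) = δ, d(v_i, u_j) = δ + 1 and d(u_i, u_j) = δ + 2 (or 0 when i = j). The formula is
-- certified by a walk of that length and by the fact that it drops by at most 1 along an edge.
-- Upper bounds: while two tracks stay more than ⌊n/2⌋ apart (⌈n/2⌉ for lazy tracks), the first
-- one can never move along the rim, since the second would then sit on the rim (or, for lazy
-- tracks, rest on a pendant antipodal to both ends of the rim edge). So the first track stays on
-- one spoke, contradicting surjectivity.
-- Lower bounds, with h = ⌊n/2⌋: two walkers circling in step with base indices h apart stay h
-- apart. For opposite tracks, a leader moving v_{a+h} → v_{a+h+1} → u_{a+h+1} while the follower waits at
-- u_a, then the follower moving u_a → v_a → v_{a+1} → u_{a+1}, keeps them ⌈n/2⌉ apart.

module Submission where

open import Defs
open import Data.Nat using (ℕ; zero; suc; _+_; _∸_; _*_; _≤_; _<_; _⊓_; ∣_-_∣; ⌊_/2⌋; ⌈_/2⌉; z≤n; s≤s; s≤s⁻¹; _≤?_; _<?_; NonZero; _≟_; z<s)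
open import Data.Nat.Properties
open import Data.Nat.DivMod using (_%_; _/_; m≡m%n+[m/n]*n; [m+kn]%n≡m%n; m%n<n; m<n⇒m%n≡m; [m+n]%n≡m%n; %-distribˡ-+; n%n≡0)
open import Data.Fin as Fin using (Fin; toℕ; fromℕ<; inject₁)
open import Data.Fin.Properties using (toℕ-injective; toℕ-fromℕ<; toℕ<n; toℕ-inject₁)
open import Data.Fin.Induction using (<-weakInduction)
open import Data.Sum using (_⊎_; inj₁; inj₂)
open import Data.Product using (Σ; ∃; _×_; _,_; proj₁; proj₂)
open import Data.Empty using (⊥-elim)
open import Relation.Binary.PropositionalEquality
open import Relation.Nullary using (¬_; yes; no)

module _ {G : Graph} where

  snoc : ∀ {x y z k} → Walk G x y k → Adj G y z → Walk G x z (suc k)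
  snoc here       e = step e here
  snoc (step a w) e = step a (snoc w e)

  cast : ∀ {x x′ y y′ k k′} → x ≡ x′ → y ≡ y′ → k ≡ k′ → Walk G x y k → Walk G x′ y′ k′
  cast refl refl refl w = w

  reverse : (∀ {x y} → Adj G x y → Adj G y x) → ∀ {x y k} → Walk G x y k → Walk G y x k
  reverse sym here       = here
  reverse sym (step a w) = snoc (reverse sym w) (sym a)

SpanAttained SpanBounded : (G : Graph) → (∀ {l} → Map G l → Map G l → Set) → ℕ → Set
SpanAttained G P k = Σ ℕ λ l → Σ (Map G l) λ f → Σ (Map G l) λ g → P f g × MinDist G f g k
SpanBounded G P k = ∀ l (f g : Map G l) k′ → P f g → MinDist G f g k′ → k′ ≤ k

module _ {G : Graph} {P Q : ∀ {l} → Map G l → Map G l → Set}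
  (P⇒Q : ∀ {l} {f g : Map G l} → P f g → Q f g) {k : ℕ} where

  SpanAttained-weaken : SpanAttained G P k → SpanAttained G Q k
  SpanAttained-weaken (l , f , g , p , apart) = l , f , g , P⇒Q p , apart

  SpanBounded-weaken : SpanBounded G Q k → SpanBounded G P k
  SpanBounded-weaken bounded l f g k′ p = bounded l f g k′ (P⇒Q p)

module Potential {G : Graph} (D : V G → V G → ℕ)
  (D-refl : ∀ x → D x x ≡ 0)
  (D-step : ∀ {x w} y → Adj G x w → D x y ≤ suc (D w y)) where

  walk-length-≥ : ∀ {x y k} → Walk G x y k → D x y ≤ k
  walk-length-≥ {x} here           = ≤-reflexive (D-refl x)
  walk-length-≥ {y = y} (step a w) = ≤-trans (D-step y a) (s≤s (walk-length-≥ w))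

  Dist-intro : (∀ x y → Walk G x y (D x y)) → ∀ x y → Dist G x y (D x y)
  Dist-intro walk x y = walk x y , λ _ → walk-length-≥

module ExactDistance {G : Graph} {D : V G → V G → ℕ} (exact : ∀ x y → Dist G x y (D x y))
  {l : ℕ} {f g : Map G l} where

  MinDist-intro : ∀ {k} (i₀ : Fin l) → D (f i₀) (g i₀) ≡ k → (∀ i → k ≤ D (f i) (g i)) → MinDist G f g k
  MinDist-intro i₀ refl k≤D = (i₀ , exact _ _) , λ i k′ d → ≤-trans (k≤D i) (proj₂ (exact _ _) k′ (proj₁ d))

  MinDist-≤ : ∀ {k} b → ¬ (∀ i → b < D (f i) (g i)) → MinDist G f g k → k ≤ b
  MinDist-≤ {k} b never (_ , minimal) with k ≤? b
  ... | yes k≤b = k≤b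
  ... | no  k≰b = ⊥-elim (never λ i → <-≤-trans (≰⇒> k≰b) (minimal i _ (exact _ _)))

consecutive-constant : ∀ {A : Set} {l} (φ : Fin l → A) →
  (∀ i j → Consec i j → φ i ≡ φ j) → ∀ i j → φ i ≡ φ j
consecutive-constant {l = suc _} φ φ-step i j = trans (≡φ₀ i) (sym (≡φ₀ j))
  where
  ≡φ₀ : ∀ i → φ i ≡ φ Fin.zero
  ≡φ₀ = <-weakInduction (λ i → φ i ≡ φ Fin.zero) refl
          λ i p → trans (sym (φ-step (inject₁ i) (Fin.suc i) (cong suc (sym (toℕ-inject₁ i))))) p

along-consecutive : (P : ℕ → ℕ → Set) → (∀ t → P t (suc t)) →
  ∀ {l} (i j : Fin l) → Consec i j → P (toℕ i) (toℕ j)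
along-consecutive P P-step i j i→j = subst (P (toℕ i)) (sym i→j) (P-step (toℕ i))

module _ (G : Graph) {l} {f g : Map G l} (opposite : Opposite G f g) where

  Opposite-lazyˡ : ∀ i j → Consec i j → Adj G (f i) (f j) ⊎ f i ≡ f j
  Opposite-lazyˡ i j i→j with opposite i j i→j
  ... | inj₁ (f-moves , _) = inj₁ f-moves
  ... | inj₂ (_ , f-rests) = inj₂ f-rests

  Opposite-lazyʳ : ∀ i j → Consec i j → Adj G (g i) (g j) ⊎ g i ≡ g j
  Opposite-lazyʳ i j i→j with opposite i j i→j
  ... | inj₁ (_ , g-rests) = inj₂ g-rests
  ... | inj₂ (g-moves , _) = inj₁ g-moves

restrict-surjective : ∀ (G : Graph) {l} (F : ℕ → V G) →
  (∀ v → ∃ λ t → t < l × F t ≡ v) → Surjective G {l} (λ i → F (toℕ i))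
restrict-surjective G F hit v with hit v
... | t , t<l , refl = fromℕ< t<l , cong F (toℕ-fromℕ< t<l)

o≤1+m⇒n∸m≤1+n∸o : ∀ n m o → o ≤ suc m → n ∸ m ≤ suc (n ∸ o)
o≤1+m⇒n∸m≤1+n∸o zero    zero    o               _         = z≤n
o≤1+m⇒n∸m≤1+n∸o zero    (suc m) o               _         = z≤n
o≤1+m⇒n∸m≤1+n∸o (suc n) zero    zero            _         = n≤1+n _
o≤1+m⇒n∸m≤1+n∸o (suc n) zero    (suc zero)      _         = ≤-refl
o≤1+m⇒n∸m≤1+n∸o (suc n) zero    (suc (suc o))   (s≤s ())
o≤1+m⇒n∸m≤1+n∸o (suc n) (suc m) zero            _         = m≤n⇒m≤1+n (m≤n⇒m≤1+n (m∸n≤m n m))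
o≤1+m⇒n∸m≤1+n∸o (suc n) (suc m) (suc o)         (s≤s o≤m) = o≤1+m⇒n∸m≤1+n∸o n m o o≤m

∣m-o∣≤1+∣1+m-o∣ : ∀ m o → ∣ m - o ∣ ≤ suc ∣ suc m - o ∣
∣m-o∣≤1+∣1+m-o∣ zero    zero    = z≤n
∣m-o∣≤1+∣1+m-o∣ (suc m) zero    = m≤n⇒m≤1+n (n≤1+n _)
∣m-o∣≤1+∣1+m-o∣ zero    (suc o) = ≤-refl
∣m-o∣≤1+∣1+m-o∣ (suc m) (suc o) = ∣m-o∣≤1+∣1+m-o∣ m o

∣1+m-o∣≤1+∣m-o∣ : ∀ m o → ∣ suc m - o ∣ ≤ suc ∣ m - o ∣
∣1+m-o∣≤1+∣m-o∣ zero    zero    = ≤-refl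
∣1+m-o∣≤1+∣m-o∣ (suc m) zero    = ≤-refl
∣1+m-o∣≤1+∣m-o∣ zero    (suc o) = m≤n⇒m≤1+n (n≤1+n o)
∣1+m-o∣≤1+∣m-o∣ (suc m) (suc o) = ∣1+m-o∣≤1+∣m-o∣ m o

m⊓n≡0⇒m≡0⊎n≡0 : ∀ m n → m ⊓ n ≡ 0 → m ≡ 0 ⊎ n ≡ 0
m⊓n≡0⇒m≡0⊎n≡0 zero    n       _ = inj₁ refl
m⊓n≡0⇒m≡0⊎n≡0 (suc m) zero    _ = inj₂ refl

m+m≤n⇒m≤⌊n/2⌋ : ∀ {m n} → m + m ≤ n → m ≤ ⌊ n /2⌋
m+m≤n⇒m≤⌊n/2⌋ {m} {n} le = subst (_≤ ⌊ n /2⌋) (sym (n≡⌊n+n/2⌋ m)) (⌊n/2⌋-mono le)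

n≤⌈n/2⌉+⌈n/2⌉ : ∀ n → n ≤ ⌈ n /2⌉ + ⌈ n /2⌉
n≤⌈n/2⌉+⌈n/2⌉ n = subst (_≤ ⌈ n /2⌉ + ⌈ n /2⌉) (⌊n/2⌋+⌈n/2⌉≡n n) (+-monoˡ-≤ ⌈ n /2⌉ (⌊n/2⌋≤⌈n/2⌉ n))

-- Points on opposite sides of e at distance d are 2d ≥ n apart, too far for two numbers below n.
equidistant-≡ : ∀ {a b e d n} → a < n → b < n → n ≤ d + d → ∣ a - e ∣ ≡ d → ∣ b - e ∣ ≡ d → a ≡ b
equidistant-≡ {a} {b} {e} a<n b<n n≤2d refl b-e with ≤-total a e | ≤-total b e
... | inj₁ a≤e | inj₁ b≤e = ∸-cancelˡ-≡ a≤e b≤e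
      (trans (sym (m≤n⇒∣m-n∣≡n∸m a≤e)) (trans (sym b-e) (m≤n⇒∣m-n∣≡n∸m b≤e)))
... | inj₂ e≤a | inj₂ e≤b = ∸-cancelʳ-≡ e≤a e≤b
      (trans (sym (m≤n⇒∣n-m∣≡n∸m e≤a)) (trans (sym b-e) (m≤n⇒∣n-m∣≡n∸m e≤b)))
... | inj₁ a≤e | inj₂ e≤b = ⊥-elim (<-irrefl refl (≤-<-trans n≤2d (≤-<-trans 2d≤b b<n)))
  where
  2d≤b : ∣ a - e ∣ + ∣ a - e ∣ ≤ b
  2d≤b = begin
    ∣ a - e ∣ + ∣ a - e ∣ ≡⟨ cong₂ _+_ (trans (sym b-e) (m≤n⇒∣n-m∣≡n∸m e≤b)) (m≤n⇒∣m-n∣≡n∸m a≤e) ⟩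
    (b ∸ e) + (e ∸ a)     ≤⟨ +-monoʳ-≤ (b ∸ e) (m∸n≤m e a) ⟩
    (b ∸ e) + e           ≡⟨ m∸n+n≡m e≤b ⟩
    b                     ∎
    where open ≤-Reasoning
... | inj₂ e≤a | inj₁ b≤e = ⊥-elim (<-irrefl refl (≤-<-trans n≤2d (≤-<-trans 2d≤a a<n)))
  where
  2d≤a : ∣ a - e ∣ + ∣ a - e ∣ ≤ a
  2d≤a = begin
    ∣ a - e ∣ + ∣ a - e ∣ ≡⟨ cong₂ _+_ (m≤n⇒∣n-m∣≡n∸m e≤a) (trans (sym b-e) (m≤n⇒∣m-n∣≡n∸m b≤e)) ⟩
    (a ∸ e) + (e ∸ b)     ≤⟨ +-monoʳ-≤ (a ∸ e) (m∸n≤m e b) ⟩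
    (a ∸ e) + e           ≡⟨ m∸n+n≡m e≤a ⟩
    a                     ∎
    where open ≤-Reasoning

module Cycle (n : ℕ) .{{_ : NonZero n}} where

  arc : ℕ → ℕ
  arc δ = δ ⊓ (n ∸ δ)

  arc-reflect : ∀ {δ} → δ ≤ n → arc (n ∸ δ) ≡ arc δ
  arc-reflect {δ} δ≤n = trans (cong ((n ∸ δ) ⊓_) (m∸[m∸n]≡n δ≤n)) (⊓-comm (n ∸ δ) δ)

  arc-step : ∀ {x y} → x ≤ suc y → y ≤ suc x → arc x ≤ suc (arc y)
  arc-step {x} {y} x≤1+y y≤1+x = ⊓-mono-≤ x≤1+y (o≤1+m⇒n∸m≤1+n∸o n x y y≤1+x)

  arc≤⌊n/2⌋ : ∀ {δ} → δ ≤ n → arc δ ≤ ⌊ n /2⌋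
  arc≤⌊n/2⌋ {δ} δ≤n = m+m≤n⇒m≤⌊n/2⌋ (begin
    arc δ + arc δ  ≤⟨ +-mono-≤ (m⊓n≤m δ (n ∸ δ)) (m⊓n≤n δ (n ∸ δ)) ⟩
    δ + (n ∸ δ)    ≡⟨ m+[n∸m]≡n δ≤n ⟩
    n              ∎)
    where open ≤-Reasoning

  arc≡0⇒δ≡0 : ∀ {δ} → δ < n → arc δ ≡ 0 → δ ≡ 0
  arc≡0⇒δ≡0 {δ} δ<n arc≡0 with m⊓n≡0⇒m≡0⊎n≡0 δ (n ∸ δ) arc≡0
  ... | inj₁ δ≡0   = δ≡0
  ... | inj₂ n∸δ≡0 = ⊥-elim (<-irrefl (sym n∸δ≡0) (m<n⇒0<n∸m δ<n))

  ⌈n/2⌉≤arc⇒δ≡⌈n/2⌉ : ∀ {δ} → δ ≤ n → ⌈ n /2⌉ ≤ arc δ → δ ≡ ⌈ n /2⌉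
  ⌈n/2⌉≤arc⇒δ≡⌈n/2⌉ {δ} δ≤n c≤arc = ≤-antisym δ≤c (m≤n⊓o⇒m≤n δ (n ∸ δ) c≤arc)
    where
    δ≤c : δ ≤ ⌈ n /2⌉
    δ≤c = +-cancelʳ-≤ ⌈ n /2⌉ δ ⌈ n /2⌉ (begin
      δ + ⌈ n /2⌉       ≤⟨ +-monoʳ-≤ δ (m≤n⊓o⇒m≤o δ (n ∸ δ) c≤arc) ⟩
      δ + (n ∸ δ)       ≡⟨ m+[n∸m]≡n δ≤n ⟩
      n                 ≤⟨ n≤⌈n/2⌉+⌈n/2⌉ n ⟩
      ⌈ n /2⌉ + ⌈ n /2⌉ ∎)
      where open ≤-Reasoning

  cycDist : Fin n → Fin n → ℕ
  cycDist i j = arc ∣ toℕ i - toℕ j ∣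

  ∣i-j∣<n : (i j : Fin n) → ∣ toℕ i - toℕ j ∣ < n
  ∣i-j∣<n i j = ≤-<-trans (∣m-n∣≤m⊔n (toℕ i) (toℕ j)) (⊔-pres-<m (toℕ<n i) (toℕ<n j))

  cycDist≤⌊n/2⌋ : ∀ i j → cycDist i j ≤ ⌊ n /2⌋
  cycDist≤⌊n/2⌋ i j = arc≤⌊n/2⌋ (<⇒≤ (∣i-j∣<n i j))

  cycDist≡0⇒≡ : ∀ {i j} → cycDist i j ≡ 0 → i ≡ j
  cycDist≡0⇒≡ {i} {j} d≡0 = toℕ-injective (∣m-n∣≡0⇒m≡n (arc≡0⇒δ≡0 (∣i-j∣<n i j) d≡0))

  antipode-unique : ∀ {a b e} → ⌈ n /2⌉ ≤ cycDist a e → ⌈ n /2⌉ ≤ cycDist b e → a ≡ b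
  antipode-unique {a} {b} {e} a-far b-far = toℕ-injective
    (equidistant-≡ (toℕ<n a) (toℕ<n b) (n≤⌈n/2⌉+⌈n/2⌉ n) (antipodal a a-far) (antipodal b b-far))
    where
    antipodal : ∀ x → ⌈ n /2⌉ ≤ cycDist x e → ∣ toℕ x - toℕ e ∣ ≡ ⌈ n /2⌉
    antipodal x = ⌈n/2⌉≤arc⇒δ≡⌈n/2⌉ (<⇒≤ (∣i-j∣<n x e))

  arc-wrap : ∀ {i e} → suc i ≡ n → e ≤ i → arc ∣ i - e ∣ ≡ arc (suc e)
  arc-wrap {i} {e} refl e≤i = begin
    arc ∣ i - e ∣           ≡⟨ cong arc (m≤n⇒∣n-m∣≡n∸m e≤i) ⟩
    arc (i ∸ e)             ≡⟨ arc-reflect (m≤n⇒m≤1+n (m∸n≤m i e)) ⟨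
    arc (suc i ∸ (i ∸ e))   ≡⟨ cong arc (trans (+-∸-assoc 1 (m∸n≤m i e)) (cong suc (m∸[m∸n]≡n e≤i))) ⟩
    arc (suc e)             ∎
    where open ≡-Reasoning

  toℕ≤last : ∀ {i} (e : Fin n) → suc i ≡ n → toℕ e ≤ i
  toℕ≤last e refl = s≤s⁻¹ (toℕ<n e)

  cycDist-step : ∀ {i j} e → CycAdj n i j → cycDist i e ≤ suc (cycDist j e)
  cycDist-step {i} e (inj₁ j≡1+i) rewrite j≡1+i =
    arc-step (∣m-o∣≤1+∣1+m-o∣ (toℕ i) (toℕ e)) (∣1+m-o∣≤1+∣m-o∣ (toℕ i) (toℕ e))
  cycDist-step {j = j} e (inj₂ (inj₁ i≡1+j)) rewrite i≡1+j =
    arc-step (∣1+m-o∣≤1+∣m-o∣ (toℕ j) (toℕ e)) (∣m-o∣≤1+∣1+m-o∣ (toℕ j) (toℕ e))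
  cycDist-step {i} e (inj₂ (inj₂ (inj₁ (1+i≡n , j≡0)))) rewrite j≡0 =
    subst (_≤ suc (arc (toℕ e))) (sym (arc-wrap 1+i≡n (toℕ≤last e 1+i≡n)))
      (arc-step ≤-refl (m≤n⇒m≤1+n (n≤1+n (toℕ e))))
  cycDist-step {j = j} e (inj₂ (inj₂ (inj₂ (1+j≡n , i≡0)))) rewrite i≡0 =
    subst (λ d → arc (toℕ e) ≤ suc d) (sym (arc-wrap 1+j≡n (toℕ≤last e 1+j≡n)))
      (arc-step (m≤n⇒m≤1+n (n≤1+n (toℕ e))) ≤-refl)

  arc-offset : ∀ {x t} → x < n → t < n → arc ∣ x - (x + t) % n ∣ ≡ arc t
  arc-offset {x} {t} x<n t<n with x + t <? n
  ... | yes x+t<n = begin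
    arc ∣ x - (x + t) % n ∣ ≡⟨ cong (λ z → arc ∣ x - z ∣) (m<n⇒m%n≡m x+t<n) ⟩
    arc ∣ x - (x + t) ∣     ≡⟨ cong arc (trans (m≤n⇒∣m-n∣≡n∸m (m≤m+n x t)) (m+n∸m≡n x t)) ⟩
    arc t                   ∎
    where open ≡-Reasoning
  ... | no  x+t≮n = begin
    arc ∣ x - (x + t) % n ∣ ≡⟨ cong (λ z → arc ∣ x - z ∣) x+t%n≡x∸s ⟩
    arc ∣ x - (x ∸ s) ∣     ≡⟨ cong arc (trans (m≤n⇒∣n-m∣≡n∸m (m∸n≤m x s)) (m∸[m∸n]≡n s≤x)) ⟩
    arc s                   ≡⟨ arc-reflect (<⇒≤ t<n) ⟩
    arc t                   ∎
    where
    open ≡-Reasoning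
    s : ℕ
    s = n ∸ t
    s≤x : s ≤ x
    s≤x = m≤n+o⇒m∸n≤o n t (subst (n ≤_) (+-comm x t) (≮⇒≥ x+t≮n))
    x+t≡x∸s+n : x + t ≡ (x ∸ s) + n
    x+t≡x∸s+n = begin
      x + t             ≡⟨ cong (_+ t) (m∸n+n≡m s≤x) ⟨
      (x ∸ s) + s + t   ≡⟨ +-assoc (x ∸ s) s t ⟩
      (x ∸ s) + (s + t) ≡⟨ cong ((x ∸ s) +_) (m∸n+n≡m (<⇒≤ t<n)) ⟩
      (x ∸ s) + n       ∎
    x+t%n≡x∸s : (x + t) % n ≡ x ∸ s
    x+t%n≡x∸s = begin
      (x + t) % n       ≡⟨ cong (_% n) x+t≡x∸s+n ⟩
      ((x ∸ s) + n) % n ≡⟨ [m+n]%n≡m%n (x ∸ s) n ⟩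
      (x ∸ s) % n       ≡⟨ m<n⇒m%n≡m (≤-<-trans (m∸n≤m x s) x<n) ⟩
      x ∸ s             ∎

  residue : ℕ → Fin n
  residue a = fromℕ< (m%n<n a n)

  toℕ-residue : ∀ a → toℕ (residue a) ≡ a % n
  toℕ-residue a = toℕ-fromℕ< (m%n<n a n)

  residue-toℕ : ∀ i → residue (toℕ i) ≡ i
  residue-toℕ i = toℕ-injective (trans (toℕ-residue (toℕ i)) (m<n⇒m%n≡m (toℕ<n i)))

  residue-+n : ∀ a → residue (a + n) ≡ residue a
  residue-+n a = toℕ-injective (trans (toℕ-residue (a + n)) (trans ([m+n]%n≡m%n a n) (sym (toℕ-residue a))))

  residue-around : ∀ b {d} → d ≤ n → residue (toℕ b + (n ∸ d) + d) ≡ b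
  residue-around b {d} d≤n = begin
    residue (toℕ b + (n ∸ d) + d)   ≡⟨ cong residue (+-assoc (toℕ b) (n ∸ d) d) ⟩
    residue (toℕ b + (n ∸ d + d))   ≡⟨ cong (λ z → residue (toℕ b + z)) (m∸n+n≡m d≤n) ⟩
    residue (toℕ b + n)             ≡⟨ residue-+n (toℕ b) ⟩
    residue (toℕ b)                 ≡⟨ residue-toℕ b ⟩
    b                               ∎
    where open ≡-Reasoning

  toℕ-residue-suc : ∀ a → toℕ (residue (suc a)) ≡ suc (a % n) % n
  toℕ-residue-suc a = begin
    toℕ (residue (suc a))                 ≡⟨ toℕ-residue (suc a) ⟩
    suc a % n                             ≡⟨ cong (λ z → suc z % n) (m≡m%n+[m/n]*n a n) ⟩
    (suc (a % n) + (a / n) * n) % n       ≡⟨ [m+kn]%n≡m%n (suc (a % n)) (a / n) n ⟩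
    suc (a % n) % n                       ∎
    where open ≡-Reasoning

  residue-adjacent : ∀ a → CycAdj n (residue a) (residue (suc a))
  residue-adjacent a with suc (a % n) ≟ n
  ... | yes 1+a%n≡n = inj₂ (inj₂ (inj₁ (trans (cong suc (toℕ-residue a)) 1+a%n≡n ,
          trans (toℕ-residue-suc a) (trans (cong (_% n) 1+a%n≡n) (n%n≡0 n)))))
  ... | no  1+a%n≢n = inj₁ (trans (toℕ-residue-suc a)
          (trans (m<n⇒m%n≡m (≤∧≢⇒< (m%n<n a n) 1+a%n≢n)) (cong suc (sym (toℕ-residue a)))))

  cycDist-offset : ∀ a {t} → t < n → cycDist (residue a) (residue (a + t)) ≡ arc t
  cycDist-offset a {t} t<n = begin
    arc ∣ toℕ (residue a) - toℕ (residue (a + t)) ∣ ≡⟨ cong₂ (λ x y → arc ∣ x - y ∣) (toℕ-residue a) (toℕ-residue (a + t)) ⟩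
    arc ∣ a % n - (a + t) % n ∣                     ≡⟨ cong (λ z → arc ∣ a % n - z ∣) (%-distribˡ-+ a t n) ⟩
    arc ∣ a % n - (a % n + t % n) % n ∣             ≡⟨ cong (λ z → arc ∣ a % n - (a % n + z) % n ∣) (m<n⇒m%n≡m t<n) ⟩
    arc ∣ a % n - (a % n + t) % n ∣                 ≡⟨ arc-offset (m%n<n a n) t<n ⟩
    arc t                                           ∎
    where open ≡-Reasoning

module Paramecium (n : ℕ) .{{_ : NonZero n}} where

  open Cycle n

  CycAdj-sym : ∀ {i j} → CycAdj n i j → CycAdj n j i
  CycAdj-sym (inj₁ p)               = inj₂ (inj₁ p)
  CycAdj-sym (inj₂ (inj₁ p))        = inj₁ p
  CycAdj-sym (inj₂ (inj₂ (inj₁ p))) = inj₂ (inj₂ (inj₂ p))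
  CycAdj-sym (inj₂ (inj₂ (inj₂ p))) = inj₂ (inj₂ (inj₁ p))

  PCAdj-sym : ∀ {x y} → PCAdj n x y → PCAdj n y x
  PCAdj-sym (cyc a) = cyc (CycAdj-sym a)
  PCAdj-sym (vu i)  = uv i
  PCAdj-sym (uv i)  = vu i

  v u : ℕ → V (PC n)
  v a = inj₁ (residue a)
  u a = inj₂ (residue a)

  ascend : ∀ a d → Walk (PC n) (v a) (v (d + a)) d
  ascend a zero    = here
  ascend a (suc d) = step (cyc (residue-adjacent a))
    (subst (λ z → Walk (PC n) (v (suc a)) (v z) d) (+-suc d a) (ascend (suc a) d))

  rim-walk-≤ : ∀ {a b} → a ≤ b → b < n → Walk (PC n) (v a) (v b) (arc (b ∸ a))
  rim-walk-≤ {a} {b} a≤b b<n with (b ∸ a) ≤? (n ∸ (b ∸ a))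
  ... | yes short = cast refl (cong v (m∸n+n≡m a≤b)) (sym (m≤n⇒m⊓n≡m short)) (ascend a (b ∸ a))
  ... | no  long  = reverse PCAdj-sym
        (cast refl around (sym (m≥n⇒m⊓n≡n (<⇒≤ (≰⇒> long)))) (ascend b (n ∸ (b ∸ a))))
    where
    δ≤n : b ∸ a ≤ n
    δ≤n = ≤-trans (m∸n≤m b a) (<⇒≤ b<n)
    around : v (n ∸ (b ∸ a) + b) ≡ v a
    around = begin
      v (n ∸ (b ∸ a) + b)             ≡⟨ cong (λ z → v (n ∸ (b ∸ a) + z)) (m∸n+n≡m a≤b) ⟨
      v (n ∸ (b ∸ a) + (b ∸ a + a))   ≡⟨ cong v (+-assoc (n ∸ (b ∸ a)) (b ∸ a) a) ⟨
      v (n ∸ (b ∸ a) + (b ∸ a) + a)   ≡⟨ cong (λ z → v (z + a)) (m∸n+n≡m δ≤n) ⟩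
      v (n + a)                       ≡⟨ cong v (+-comm n a) ⟩
      v (a + n)                       ≡⟨ cong inj₁ (residue-+n a) ⟩
      v a                             ∎
      where open ≡-Reasoning

  v-toℕ : ∀ i → v (toℕ i) ≡ inj₁ i
  v-toℕ i = cong inj₁ (residue-toℕ i)

  u-toℕ : ∀ i → u (toℕ i) ≡ inj₂ i
  u-toℕ i = cong inj₂ (residue-toℕ i)

  v-around : ∀ b {d} → d ≤ n → v (toℕ b + (n ∸ d) + d) ≡ inj₁ b
  v-around b d≤n = cong inj₁ (residue-around b d≤n)

  u-around : ∀ b {d} → d ≤ n → u (toℕ b + (n ∸ d) + d) ≡ inj₂ b
  u-around b d≤n = cong inj₂ (residue-around b d≤n)

  rim-walk : ∀ i j → Walk (PC n) (inj₁ i) (inj₁ j) (cycDist i j)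
  rim-walk i j with ≤-total (toℕ i) (toℕ j)
  ... | inj₁ i≤j = cast (v-toℕ i) (v-toℕ j) (cong arc (sym (m≤n⇒∣m-n∣≡n∸m i≤j)))
                     (rim-walk-≤ i≤j (toℕ<n j))
  ... | inj₂ j≤i = cast (v-toℕ i) (v-toℕ j) (cong arc (sym (m≤n⇒∣n-m∣≡n∸m j≤i)))
                     (reverse PCAdj-sym (rim-walk-≤ j≤i (toℕ<n i)))

  pendantDist : ℕ → ℕ
  pendantDist zero    = zero
  pendantDist (suc k) = suc (suc (suc k))

  k≤pendantDist : ∀ k → k ≤ pendantDist k
  k≤pendantDist zero    = z≤n
  k≤pendantDist (suc k) = m≤n⇒m≤1+n (m≤n⇒m≤1+n ≤-refl)

  pendantDist≤2+k : ∀ k → pendantDist k ≤ suc (suc k)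
  pendantDist≤2+k zero    = z≤n
  pendantDist≤2+k (suc k) = ≤-refl

  pcDist : V (PC n) → V (PC n) → ℕ
  pcDist (inj₁ i) (inj₁ j) = cycDist i j
  pcDist (inj₁ i) (inj₂ j) = suc (cycDist i j)
  pcDist (inj₂ i) (inj₁ j) = suc (cycDist i j)
  pcDist (inj₂ i) (inj₂ j) = pendantDist (cycDist i j)

  cycDist-refl : ∀ i → cycDist i i ≡ 0
  cycDist-refl i rewrite ∣n-n∣≡0 (toℕ i) = refl

  pcDist-refl : ∀ x → pcDist x x ≡ 0
  pcDist-refl (inj₁ i) = cycDist-refl i
  pcDist-refl (inj₂ i) = cong pendantDist (cycDist-refl i)

  pcDist-step : ∀ {x w} y → PCAdj n x w → pcDist x y ≤ suc (pcDist w y)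
  pcDist-step (inj₁ e) (cyc a) = cycDist-step e a
  pcDist-step (inj₂ e) (cyc a) = s≤s (cycDist-step e a)
  pcDist-step (inj₁ e) (vu i)  = m≤n⇒m≤1+n (n≤1+n _)
  pcDist-step (inj₂ e) (vu i)  = s≤s (k≤pendantDist _)
  pcDist-step (inj₁ e) (uv i)  = ≤-refl
  pcDist-step (inj₂ e) (uv i)  = pendantDist≤2+k _

  pcDist-walk : ∀ x y → Walk (PC n) x y (pcDist x y)
  pcDist-walk (inj₁ i) (inj₁ j) = rim-walk i j
  pcDist-walk (inj₁ i) (inj₂ j) = snoc (rim-walk i j) (vu j)
  pcDist-walk (inj₂ i) (inj₁ j) = step (uv i) (rim-walk i j)
  pcDist-walk (inj₂ i) (inj₂ j) with cycDist i j in d≡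
  ... | zero  = subst (λ z → Walk (PC n) (inj₂ i) (inj₂ z) 0) (cycDist≡0⇒≡ d≡) here
  ... | suc k = step (uv i) (snoc (cast refl refl d≡ (rim-walk i j)) (vu j))

  pcDist-exact : ∀ x y → Dist (PC n) x y (pcDist x y)
  pcDist-exact = Potential.Dist-intro pcDist pcDist-refl pcDist-step pcDist-walk

module UpperBounds (n : ℕ) .{{_ : NonZero n}} (1<n : 1 < n) where

  open Cycle n
  open Paramecium n

  rim : V (PC n) → Fin n
  rim (inj₁ i) = i
  rim (inj₂ i) = i

  CycAdj-irrefl : ∀ {i} → ¬ CycAdj n i i
  CycAdj-irrefl (inj₁ p)                     = 1+n≢n (sym p)
  CycAdj-irrefl (inj₂ (inj₁ p))              = 1+n≢n (sym p)
  CycAdj-irrefl (inj₂ (inj₂ (inj₁ (p , q)))) = <-irrefl (trans (cong suc (sym q)) p) 1<n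
  CycAdj-irrefl (inj₂ (inj₂ (inj₂ (p , q)))) = <-irrefl (trans (cong suc (sym q)) p) 1<n

  0<n : 0 < n
  0<n = <-trans z<s 1<n

  h≤c : ⌊ n /2⌋ ≤ ⌈ n /2⌉
  h≤c = ⌊n/2⌋≤⌈n/2⌉ n

  rim-not-far : ∀ {b} i j → ⌊ n /2⌋ ≤ b → ¬ (b < cycDist i j)
  rim-not-far i j h≤b b<d = <-irrefl refl (<-≤-trans b<d (≤-trans (cycDist≤⌊n/2⌋ i j) h≤b))

  track-step-keeps-rim : ∀ {x x′ y y′} → PCAdj n x x′ → PCAdj n y y′ →
    ⌊ n /2⌋ < pcDist x y → ⌊ n /2⌋ < pcDist x′ y′ → rim x ≡ rim x′
  track-step-keeps-rim (vu _)        _               _   _    = refl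
  track-step-keeps-rim (uv _)        _               _   _    = refl
  track-step-keeps-rim (cyc {a} _)   (cyc {e} _)     far _    = ⊥-elim (rim-not-far a e ≤-refl far)
  track-step-keeps-rim (cyc {a} _)   (vu e)          far _    = ⊥-elim (rim-not-far a e ≤-refl far)
  track-step-keeps-rim (cyc {j = b} _) (uv e)        _   far′ = ⊥-elim (rim-not-far b e ≤-refl far′)

  lazy-step-keeps-rim : ∀ {x x′ y y′} → PCAdj n x x′ ⊎ x ≡ x′ → PCAdj n y y′ ⊎ y ≡ y′ →
    ⌈ n /2⌉ < pcDist x y → ⌈ n /2⌉ < pcDist x′ y′ → rim x ≡ rim x′
  lazy-step-keeps-rim (inj₂ refl)            _                  _   _    = refl
  lazy-step-keeps-rim (inj₁ (vu _))          _                  _   _    = refl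
  lazy-step-keeps-rim (inj₁ (uv _))          _                  _   _    = refl
  lazy-step-keeps-rim (inj₁ (cyc {a} _))     (inj₁ (cyc {e} _)) far _    = ⊥-elim (rim-not-far a e h≤c far)
  lazy-step-keeps-rim (inj₁ (cyc {a} _))     (inj₁ (vu e))      far _    = ⊥-elim (rim-not-far a e h≤c far)
  lazy-step-keeps-rim (inj₁ (cyc {j = b} _)) (inj₁ (uv e))      _   far′ = ⊥-elim (rim-not-far b e h≤c far′)
  lazy-step-keeps-rim {y = inj₁ e} (inj₁ (cyc {a} _)) (inj₂ refl) far _  = ⊥-elim (rim-not-far a e h≤c far)
  lazy-step-keeps-rim {y = inj₂ e} (inj₁ (cyc {a} {b} a~b)) (inj₂ refl) far far′ =
    ⊥-elim (CycAdj-irrefl (subst (CycAdj n a) (sym (antipode-unique (s≤s⁻¹ far) (s≤s⁻¹ far′))) a~b))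

  surjective-rim-varies : ∀ {l} {f : Map (PC n) l} → Surjective (PC n) f → ¬ (∀ i j → rim (f i) ≡ rim (f j))
  surjective-rim-varies {f = f} onto constant with onto (inj₁ (fromℕ< 0<n)) | onto (inj₁ (fromℕ< 1<n))
  ... | i , fi≡0 | j , fj≡1 = 0≢1+n (begin
    0                             ≡⟨ toℕ-fromℕ< 0<n ⟨
    toℕ (fromℕ< 0<n)              ≡⟨ cong (λ x → toℕ (rim x)) fi≡0 ⟨
    toℕ (rim (f i))               ≡⟨ cong toℕ (constant i j) ⟩
    toℕ (rim (f j))               ≡⟨ cong (λ x → toℕ (rim x)) fj≡1 ⟩
    toℕ (fromℕ< 1<n)              ≡⟨ toℕ-fromℕ< 1<n ⟩
    1                             ∎)
    where open ≡-Reasoning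

  direct-span-≤ : SpanBounded (PC n) (λ f g → Track (PC n) f × Track (PC n) g) ⌊ n /2⌋
  direct-span-≤ l f g k ((f-onto , f-step) , (_ , g-step)) =
    ExactDistance.MinDist-≤ pcDist-exact ⌊ n /2⌋ λ far → surjective-rim-varies f-onto
      (consecutive-constant (λ i → rim (f i)) λ i j i→j →
        track-step-keeps-rim (f-step i j i→j) (g-step i j i→j) (far i) (far j))

  strong-span-≤ : SpanBounded (PC n) (λ f g → LazyTrack (PC n) f × LazyTrack (PC n) g) ⌈ n /2⌉
  strong-span-≤ l f g k ((f-onto , f-step) , (_ , g-step)) =
    ExactDistance.MinDist-≤ pcDist-exact ⌈ n /2⌉ λ far → surjective-rim-varies f-onto
      (consecutive-constant (λ i → rim (f i)) λ i j i→j →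
        lazy-step-keeps-rim (f-step i j i→j) (g-step i j i→j) (far i) (far j))

module Witnesses (m : ℕ) where

  n : ℕ
  n = suc (suc (suc m))

  open Cycle n
  open Paramecium n

  h c : ℕ
  h = ⌊ n /2⌋
  c = ⌈ n /2⌉

  h+c≡n : h + c ≡ n
  h+c≡n = ⌊n/2⌋+⌈n/2⌉≡n n

  n∸h≡c : n ∸ h ≡ c
  n∸h≡c = trans (cong (_∸ h) (sym h+c≡n)) (m+n∸m≡n h c)

  c≤1+h : c ≤ suc h
  c≤1+h = ⌊n/2⌋-mono (n≤1+n (suc n))

  1+h<n : suc h < n
  1+h<n = begin
    suc (suc h)   ≡⟨ +-comm 2 h ⟩
    h + 2         ≤⟨ +-monoʳ-≤ h (s≤s (s≤s z≤n)) ⟩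
    h + c         ≡⟨ h+c≡n ⟩
    n             ∎
    where open ≤-Reasoning

  h<n : h < n
  h<n = <-trans (n<1+n h) 1+h<n

  cycDist-+h : ∀ a → cycDist (residue a) (residue (a + h)) ≡ h
  cycDist-+h a = trans (cycDist-offset a h<n) (m≤n⇒m⊓n≡m (subst (h ≤_) (sym n∸h≡c) (⌊n/2⌋≤⌈n/2⌉ n)))

  1+cycDist-+1+h : ∀ a → suc (cycDist (residue a) (residue (suc (a + h)))) ≡ c
  1+cycDist-+1+h a = begin
    suc (cycDist (residue a) (residue (suc (a + h)))) ≡⟨ cong (λ z → suc (cycDist (residue a) (residue z))) (+-suc a h) ⟨
    suc (cycDist (residue a) (residue (a + suc h)))   ≡⟨ cong suc (cycDist-offset a 1+h<n) ⟩
    suc (suc h ⊓ (n ∸ suc h))                         ≡⟨ cong suc (m≥n⇒m⊓n≡n n∸1+h≤1+h) ⟩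
    suc (n ∸ suc h)                                   ≡⟨ +-∸-assoc 1 h<n ⟨
    n ∸ h                                             ≡⟨ n∸h≡c ⟩
    c                                                 ∎
    where
    open ≡-Reasoning
    n∸1+h≤1+h : n ∸ suc h ≤ suc h
    n∸1+h≤1+h = ≤-trans (∸-monoʳ-≤ n (n≤1+n h)) (≤-trans (≤-reflexive n∸h≡c) c≤1+h)

  -- The case k = 0 is absurd because c reduces to 2 + ⌊ m /2⌋.
  c≤pendantDist : ∀ {k} → suc k ≡ c → c ≤ pendantDist k
  c≤pendantDist {suc k} refl = n≤1+n _

  1+h≤pendantDist-h : suc h ≤ pendantDist h
  1+h≤pendantDist-h = n≤1+n _

  round< : ∀ (b : Fin n) d → toℕ b + (n ∸ d) < n + n
  round< b d = +-mono-<-≤ (toℕ<n b) (m∸n≤m n d)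

  toℕ<n+n : ∀ (b : Fin n) → toℕ b < n + n
  toℕ<n+n b = <-≤-trans (toℕ<n b) (m≤m+n n n)

  phase< : ∀ {K r a} → r < K → a < n + n → r + a * K < (n + n) * K
  phase< {K} {r} {a} r<K a<2n = ≤-trans (+-monoˡ-≤ (a * K) r<K) (*-monoˡ-≤ K a<2n)

  data Phase₃ : Set where
    p₀ p₁ p₂ : Phase₃

  tick₃ : ℕ × Phase₃ → ℕ × Phase₃
  tick₃ (a , p₀) = a , p₁
  tick₃ (a , p₁) = a , p₂
  tick₃ (a , p₂) = suc a , p₀

  clock₃ : ℕ → ℕ × Phase₃
  clock₃ zero    = 0 , p₀
  clock₃ (suc t) = tick₃ (clock₃ t)

  clock₃-round : ∀ a → clock₃ (a * 3) ≡ (a , p₀)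
  clock₃-round zero    = refl
  clock₃-round (suc a) = cong (λ s → tick₃ (tick₃ (tick₃ s))) (clock₃-round a)

  walker : ℕ → ℕ × Phase₃ → V (PC n)
  walker s (a , p₀) = v (a + s)
  walker s (a , p₁) = u (a + s)
  walker s (a , p₂) = v (a + s)

  walker-step : ∀ s st → PCAdj n (walker s st) (walker s (tick₃ st))
  walker-step s (a , p₀) = vu _
  walker-step s (a , p₁) = uv _
  walker-step s (a , p₂) = cyc (residue-adjacent (a + s))

  walker-onto : ∀ {s} → s ≤ n → ∀ x → ∃ λ t → t < (n + n) * 3 × walker s (clock₃ t) ≡ x
  walker-onto {s} s≤n (inj₁ b) = 0 + a * 3 , phase< (s≤s z≤n) (round< b s) ,
    trans (cong (walker s) (clock₃-round a)) (v-around b s≤n)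
    where a = toℕ b + (n ∸ s)
  walker-onto {s} s≤n (inj₂ b) = 1 + a * 3 , phase< (s≤s (s≤s z≤n)) (round< b s) ,
    trans (cong (λ st → walker s (tick₃ st)) (clock₃-round a)) (u-around b s≤n)
    where a = toℕ b + (n ∸ s)

  walker-track : ∀ {s} → s ≤ n → Track (PC n) {(n + n) * 3} (λ i → walker s (clock₃ (toℕ i)))
  walker-track {s} s≤n = restrict-surjective (PC n) (λ t → walker s (clock₃ t)) (walker-onto s≤n) ,
    along-consecutive (λ t t′ → PCAdj n (walker s (clock₃ t)) (walker s (clock₃ t′)))
      (λ t → walker-step s (clock₃ t))

  walkers-apart : ∀ st → h ≤ pcDist (walker 0 st) (walker h st)
  walkers-apart (a , p) = apart p
    where
    rim-apart : cycDist (residue (a + 0)) (residue (a + h)) ≡ h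
    rim-apart = trans (cong (λ z → cycDist (residue z) (residue (a + h))) (+-identityʳ a)) (cycDist-+h a)
    apart : ∀ p → h ≤ pcDist (walker 0 (a , p)) (walker h (a , p))
    apart p₀ = ≤-reflexive (sym rim-apart)
    apart p₁ = ≤-trans (≤-reflexive (sym rim-apart)) (k≤pendantDist _)
    apart p₂ = ≤-reflexive (sym rim-apart)

  direct-pair : SpanAttained (PC n) (λ f g → Track (PC n) f × Track (PC n) g) h
  direct-pair = (n + n) * 3 , f , g , (walker-track z≤n , walker-track (<⇒≤ h<n)) ,
    ExactDistance.MinDist-intro pcDist-exact Fin.zero (cycDist-+h 0) (λ i → walkers-apart (clock₃ (toℕ i)))
    where
    f g : Map (PC n) ((n + n) * 3)
    f i = walker 0 (clock₃ (toℕ i))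
    g i = walker h (clock₃ (toℕ i))

  data Phase₆ : Set where
    q₀ q₁ q₂ q₃ q₄ q₅ : Phase₆

  tick₆ : ℕ × Phase₆ → ℕ × Phase₆
  tick₆ (a , q₀) = a , q₁
  tick₆ (a , q₁) = a , q₂
  tick₆ (a , q₂) = a , q₃
  tick₆ (a , q₃) = a , q₄
  tick₆ (a , q₄) = a , q₅
  tick₆ (a , q₅) = suc a , q₀

  clock₆ : ℕ → ℕ × Phase₆
  clock₆ zero    = 0 , q₀
  clock₆ (suc t) = tick₆ (clock₆ t)

  clock₆-round : ∀ a → clock₆ (a * 6) ≡ (a , q₀)
  clock₆-round zero    = refl
  clock₆-round (suc a) = cong (λ s → tick₆ (tick₆ (tick₆ (tick₆ (tick₆ (tick₆ s)))))) (clock₆-round a)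

  follower leader : ℕ × Phase₆ → V (PC n)
  follower (a , q₀) = u a
  follower (a , q₁) = u a
  follower (a , q₂) = u a
  follower (a , q₃) = v a
  follower (a , q₄) = v (suc a)
  follower (a , q₅) = u (suc a)
  leader (a , q₀) = v (a + h)
  leader (a , q₁) = v (suc (a + h))
  leader (a , q₂) = u (suc (a + h))
  leader (a , q₃) = u (suc (a + h))
  leader (a , q₄) = u (suc (a + h))
  leader (a , q₅) = u (suc (a + h))

  alternate : ∀ st →
    (PCAdj n (follower st) (follower (tick₆ st)) × leader st ≡ leader (tick₆ st)) ⊎
    (PCAdj n (leader st) (leader (tick₆ st)) × follower st ≡ follower (tick₆ st))
  alternate (a , q₀) = inj₂ (cyc (residue-adjacent (a + h)) , refl)
  alternate (a , q₁) = inj₂ (vu _ , refl)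
  alternate (a , q₂) = inj₁ (uv _ , refl)
  alternate (a , q₃) = inj₁ (cyc (residue-adjacent a) , refl)
  alternate (a , q₄) = inj₁ (vu _ , refl)
  alternate (a , q₅) = inj₂ (uv _ , refl)

  follower-onto : ∀ x → ∃ λ t → t < (n + n) * 6 × follower (clock₆ t) ≡ x
  follower-onto (inj₁ b) = 3 + toℕ b * 6 , phase< (s≤s (s≤s (s≤s (s≤s z≤n)))) (toℕ<n+n b) ,
    trans (cong (λ st → follower (tick₆ (tick₆ (tick₆ st)))) (clock₆-round (toℕ b))) (v-toℕ b)
  follower-onto (inj₂ b) = 0 + toℕ b * 6 , phase< (s≤s z≤n) (toℕ<n+n b) ,
    trans (cong follower (clock₆-round (toℕ b))) (u-toℕ b)

  leader-onto : ∀ x → ∃ λ t → t < (n + n) * 6 × leader (clock₆ t) ≡ x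
  leader-onto (inj₁ b) = 0 + a * 6 , phase< (s≤s z≤n) (round< b h) ,
    trans (cong leader (clock₆-round a)) (v-around b (<⇒≤ h<n))
    where a = toℕ b + (n ∸ h)
  leader-onto (inj₂ b) = 2 + a * 6 , phase< (s≤s (s≤s (s≤s z≤n))) (round< b (suc h)) ,
    trans (cong (λ st → leader (tick₆ (tick₆ st))) (clock₆-round a))
          (trans (cong u (sym (+-suc a h))) (u-around b (<⇒≤ 1+h<n)))
    where a = toℕ b + (n ∸ suc h)

  follower-leader-apart : ∀ st → c ≤ pcDist (follower st) (leader st)
  follower-leader-apart (a , q₀) = ≤-trans c≤1+h (≤-reflexive (cong suc (sym (cycDist-+h a))))
  follower-leader-apart (a , q₁) = ≤-reflexive (sym (1+cycDist-+1+h a))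
  follower-leader-apart (a , q₂) = c≤pendantDist (1+cycDist-+1+h a)
  follower-leader-apart (a , q₃) = ≤-reflexive (sym (1+cycDist-+1+h a))
  follower-leader-apart (a , q₄) = ≤-trans c≤1+h (≤-reflexive (cong suc (sym (cycDist-+h (suc a)))))
  follower-leader-apart (a , q₅) = ≤-trans c≤1+h
    (≤-trans 1+h≤pendantDist-h (≤-reflexive (cong pendantDist (sym (cycDist-+h (suc a))))))

  opposite-pair : SpanAttained (PC n) (λ f g → LazyTrack (PC n) f × LazyTrack (PC n) g × Opposite (PC n) f g) c
  opposite-pair = (n + n) * 6 , f , g ,
    ( (restrict-surjective (PC n) (λ t → follower (clock₆ t)) follower-onto , Opposite-lazyˡ (PC n) opposite)
    , (restrict-surjective (PC n) (λ t → leader (clock₆ t)) leader-onto , Opposite-lazyʳ (PC n) opposite)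
    , opposite) ,
    ExactDistance.MinDist-intro pcDist-exact (Fin.suc Fin.zero) (1+cycDist-+1+h 0)
      (λ i → follower-leader-apart (clock₆ (toℕ i)))
    where
    f g : Map (PC n) ((n + n) * 6)
    f i = follower (clock₆ (toℕ i))
    g i = leader (clock₆ (toℕ i))
    opposite : Opposite (PC n) f g
    opposite = along-consecutive
      (λ t t′ → (PCAdj n (follower (clock₆ t)) (follower (clock₆ t′)) × leader (clock₆ t) ≡ leader (clock₆ t′)) ⊎
                (PCAdj n (leader (clock₆ t)) (leader (clock₆ t′)) × follower (clock₆ t) ≡ follower (clock₆ t′)))
      (λ t → alternate (clock₆ t))

theorem5p4 : (n : ℕ) → 3 ≤ n →
    DirectSpan (PC n) ⌊ n /2⌋ × CartesianSpan (PC n) ⌈ n /2⌉ × StrongSpan (PC n) ⌈ n /2⌉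
theorem5p4 n@(suc (suc (suc m))) (s≤s (s≤s (s≤s _))) =
  (direct-pair , direct-span-≤) ,
  (opposite-pair , SpanBounded-weaken forget-opposite strong-span-≤) ,
  (SpanAttained-weaken forget-opposite opposite-pair , strong-span-≤)
  where
  open UpperBounds n (s≤s (s≤s z≤n))
  open Witnesses m hiding (n)
  forget-opposite : ∀ {l} {f g : Map (PC n) l} →
    LazyTrack (PC n) f × LazyTrack (PC n) g × Opposite (PC n) f g → LazyTrack (PC n) f × LazyTrack (PC n) g
  forget-opposite (f-lazy , g-lazy , _) = f-lazy , g-lazy
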